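{- Let $\lesssim$ be a plausible preorder on $\mathcal{T}$ and $E(\cdot|\cdot)$ the conditional expectation naturally induced by it; write $P(C|D)=E(C|D)$. Let $X$ be a random quantity and $C,D$ events. If the expression $\frac{E(X.C|D)}{P(C|D)}$ makes sense (numerator and denominator are defined and the quotient is defined in extended-real arithmetic), then \[E(X|C.D)=\frac{E(X.C|D)}{P(C|D)}.\]
   Context: Random quantities: $\mathcal{T}$ is a unital associative commutative algebra over $\mathbb{R}$; reals $r$ are identified with $r\mathbf{1}$; products are written $X.Y$. Events: idempotents $A$ ($A.A=A$). Plausible preorder: a relation $\lesssim$ on $\mathcal{T}$ with (i) $0\lesssim A$ for every event $A$; (ii) $0\lesssim X$ and $0\lesssim Y$ imply $0\lesssim X+Y$; (iii) $0\lesssim X$ and real $q\ge0$ imply $0\lesssim qX$; (iv) $X\lesssim Y$ iff $0\lesssim Y-X$. Strict part: $X\lnsim Y$ iff $X\lesssim Y$ and not $Y\lesssim X$. Conditional preorder: $X\lesssim_C Y$ iff $X.C\lesssim Y.C$; strict part $\lnsim_C$. Expectation induced by a plausible preorder: $E(X)$ is the real $x$ if $-\epsilon\lnsim X-x\lnsim\epsilon$ for all reals $\epsilon>0$; it is $+\infty$ if $y\lnsim X$ for all reals $y$; it is $-\infty$ if $X\lnsim y$ for all reals $y$; it is undefined otherwise. Conditional expectation: $E(X|C)$ is the expectation induced by $\lesssim_C$. Conditional probability: $P(C|D)=E(C|D)$. Extended-real division: $x/y$ is defined (with the usual value) when - $x,y$ are real and $y\neq0$; - $x$ is real and $y=\pm\infty$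 (value $0$); - $x=\pm\infty$ and $y$ is a nonzero real (value $\pm\infty$ with the usual sign rule). All other quotients, including $x/0$ and $(\pm\infty)/(\pm\infty)$, are undefined. -}

module Defs where

open import Level using (0ℓ)
open import Data.Product using (Σ; ∃; _×_; _,_)
open import Data.Sum using (_⊎_)
open import Relation.Nullary using (¬_)
open import Relation.Binary.PropositionalEquality using (_≡_; _≢_)
open import Relation.Binary.Structures using (IsStrictTotalOrder)
open import Algebra.Structures using (IsCommutativeRing)

-- The real numbers, axiomatised as a complete ordered field.
-- (agda-stdlib has no reals; every theorem is proved for an arbitrary
-- model of these axioms, i.e. for ℝ up to isomorphism.)

record RealField : Set₁ where
  infixl 7 _*_
  infixl 6 _+_
  infix 4 _<_ _≤_
  field
    Carrier : Set
    _+_ _*_ : Carrier → Carrier → Carrier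
    -_      : Carrier → Carrier
    0# 1#   : Carrier
    _⁻¹     : Carrier → Carrier
    _<_     : Carrier → Carrier → Set
    isCommutativeRing : IsCommutativeRing _≡_ _+_ _*_ -_ 0# 1#
    0≢1      : 0# ≢ 1#
    ⁻¹-inverse : ∀ x → x ≢ 0# → x * (x ⁻¹) ≡ 1#
    <-isStrictTotalOrder : IsStrictTotalOrder _≡_ _<_
    +-mono-< : ∀ {x y} z → x < y → x + z < y + z
    *-pos    : ∀ {x y} → 0# < x → 0# < y → 0# < x * y

  _≤_ : Carrier → Carrier → Set
  x ≤ y = x < y ⊎ x ≡ y

  IsUpperBound : (Carrier → Set) → Carrier → Set
  IsUpperBound S b = ∀ x → S x → x ≤ b

  IsSupremum : (Carrier → Set) → Carrier → Set
  IsSupremum S s = IsUpperBound S s × (∀ b → IsUpperBound S b → s ≤ b)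

  field
    complete : ∀ (S : Carrier → Set) → ∃ S → ∃ (IsUpperBound S) → ∃ (IsSupremum S)

-- Random quantities: a unital associative commutative ℝ-algebra 𝒯.
-- The ℝ-algebra structure is given by the unital ring homomorphism
-- ι : ℝ → 𝒯, r ↦ r𝟏 (reals are identified with r𝟏); qX = ι q . X.

record RAlgebra (R : RealField) : Set₁ where
  private module R = RealField R
  infixl 7 _∙_
  infixl 6 _+_
  field
    Carrier : Set
    _+_ _∙_ : Carrier → Carrier → Carrier
    -_      : Carrier → Carrier
    0# 1#   : Carrier
    isCommutativeRing : IsCommutativeRing _≡_ _+_ _∙_ -_ 0# 1#
    ι       : R.Carrier → Carrier
    ι-+     : ∀ a b → ι (a R.+ b) ≡ ι a + ι b
    ι-*     : ∀ a b → ι (a R.* b) ≡ ι a ∙ ι b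
    ι-1     : ι R.1# ≡ 1#

  infixl 6 _-_
  _-_ : Carrier → Carrier → Carrier
  X - Y = X + (- Y)

  _·_ : R.Carrier → Carrier → Carrier
  q · X = ι q ∙ X

  IsEvent : Carrier → Set
  IsEvent A = A ∙ A ≡ A

module _ {R : RealField} (T : RAlgebra R) where
  private
    module R = RealField R
    module T = RAlgebra T

  record IsPlausible (_≲_ : T.Carrier → T.Carrier → Set) : Set where
    field
      events-nonneg : ∀ A → T.IsEvent A → T.0# ≲ A
      +-nonneg      : ∀ X Y → T.0# ≲ X → T.0# ≲ Y → T.0# ≲ (X T.+ Y)
      ·-nonneg      : ∀ X q → T.0# ≲ X → R.0# R.≤ q → T.0# ≲ (q T.· X)
      ≲⇒diff        : ∀ X Y → X ≲ Y → T.0# ≲ (Y T.- X)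
      diff⇒≲        : ∀ X Y → T.0# ≲ (Y T.- X) → X ≲ Y

  Strict : (T.Carrier → T.Carrier → Set) → T.Carrier → T.Carrier → Set
  Strict _≲_ X Y = X ≲ Y × ¬ (Y ≲ X)

  Cond : (T.Carrier → T.Carrier → Set) → T.Carrier → T.Carrier → T.Carrier → Set
  Cond _≲_ C X Y = (X T.∙ C) ≲ (Y T.∙ C)

data ExtReal (R : RealField) : Set where
  fin : RealField.Carrier R → ExtReal R
  +∞  : ExtReal R
  -∞  : ExtReal R

-- Extended-real division as a relation:  DivIs x y z  means  "x / y is
-- defined and equals z".  Exactly the listed cases are defined.
module _ {R : RealField} where
  private module R = RealField R

  data DivIs : ExtReal R → ExtReal R → ExtReal R → Set where
    fin/fin : ∀ x y → y ≢ R.0# → DivIs (fin x) (fin y) (fin (x R.* (y R.⁻¹)))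
    fin/+∞  : ∀ x → DivIs (fin x) +∞ (fin R.0#)
    fin/-∞  : ∀ x → DivIs (fin x) -∞ (fin R.0#)
    +∞/pos  : ∀ y → R.0# R.< y → DivIs +∞ (fin y) +∞
    +∞/neg  : ∀ y → y R.< R.0# → DivIs +∞ (fin y) -∞
    -∞/pos  : ∀ y → R.0# R.< y → DivIs -∞ (fin y) -∞
    -∞/neg  : ∀ y → y R.< R.0# → DivIs -∞ (fin y) +∞

-- Expectation induced by a preorder, as the relation  "E(X) is defined
-- and equals v"  (E(X) is undefined iff no clause applies).

module _ {R : RealField} (T : RAlgebra R) where
  private
    module R = RealField R
    module T = RAlgebra T

  ExpIs : (T.Carrier → T.Carrier → Set) → T.Carrier → ExtReal R → Set
  ExpIs _≲_ X (fin x) =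
    ∀ ε → R.0# R.< ε →
      Strict T _≲_ (T.ι (R.- ε)) (X T.- T.ι x) × Strict T _≲_ (X T.- T.ι x) (T.ι ε)
  ExpIs _≲_ X +∞ = ∀ y → Strict T _≲_ (T.ι y) X
  ExpIs _≲_ X -∞ = ∀ y → Strict T _≲_ X (T.ι y)

  CondExpIs : (T.Carrier → T.Carrier → Set) → T.Carrier → T.Carrier → ExtReal R → Set
  CondExpIs _≲_ X C v = ExpIs (Cond T _≲_ C) X v

  CondProbIs : (T.Carrier → T.Carrier → Set) → T.Carrier → T.Carrier → ExtReal R → Set
  CondProbIs _≲_ C D v = CondExpIs _≲_ C D v

-- Conditioning on an event D turns ≲ into another plausible preorder ≲_D, and conditioning ≲_D on C
-- is conditioning ≲ on C.D; so it suffices to prove E(X|C) = E(X.C) / E(C) for a single plausible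
-- preorder ≼. Since 0 ≼ C ≼ 1, the expectation p of C is a real with p ≥ 0, hence p > 0 whenever the
-- quotient is defined, and C − p lies within every ε > 0 of 0; so does s(C − p) for every real s.
-- If E(X.C) = qp, then with η = εp/2
--   (q − ε)C ≼ (q − ε)p + η = qp − η ≺ X.C ≺ qp + η = (q + ε)p − η ≼ (q + ε)C,
-- which is E(X|C) = q. If E(X.C) = +∞, then yC ≼ yp + p ≺ X.C for every real y, i.e. E(X|C) = +∞;
-- −∞ is symmetric.

module Submission where

open import Level using (0ℓ)
open import Algebra.Bundles using (CommutativeRing)
open import Data.Empty using (⊥-elim)
open import Data.Integer.Base using (0ℤ)
open import Data.Maybe.Base as Maybe using (Maybe)
open import Data.Product using (_×_; _,_; proj₁; proj₂)
open import Data.Sum using (inj₁)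
open import Relation.Binary.Consequences using (dec⇒weaklyDec)
open import Relation.Binary.Definitions using (tri<; tri≈; tri>)
open import Relation.Binary.PropositionalEquality as ≡ using (_≡_; _≢_; subst; subst₂; cong)
open import Relation.Binary.Structures using (IsStrictTotalOrder)
open import Relation.Nullary using (¬_)

open import Defs

-- Tactic.RingSolver cannot recognise the operations of a ring that is a module parameter, and a
-- normalising solver needs coefficients with decidable equality: ℤ maps into every commutative ring.
module ℤ-RingSolver (R : CommutativeRing 0ℓ 0ℓ) where
  open import Data.Integer.Base as ℤ using (ℤ; +_; -[1+_]; sign; ∣_∣; _◃_)
  import Data.Integer.Properties as ℤ
  open import Data.Nat.Base as ℕ using (zero; suc)
  import Data.Nat.Properties as ℕ
  open import Data.Sign.Base as Sign using (Sign)
  open CommutativeRing R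
  open import Algebra.Properties.Ring ring using (-0#≈0#; -1*x≈-x; -‿involutive)
  open import Algebra.Properties.AbelianGroup +-abelianGroup using (⁻¹-∙-comm)
  open import Algebra.Properties.Semiring.Mult semiring using (×-homo-+; ×1-homo-*) renaming (_×_ to _·_)
  open import Algebra.Properties.CommutativeSemigroup using (interchange)
  open import Algebra.Solver.Ring.AlmostCommutativeRing
    using (fromCommutativeRing; _-Raw-AlmostCommutative⟶_)
  open import Relation.Binary.Reasoning.Setoid setoid

  ⟦_⟧ : ℤ → Carrier
  ⟦ + n ⟧ = n · 1#
  ⟦ -[1+ n ] ⟧ = - (suc n · 1#)

  ⟦⊖⟧ : ∀ m n → ⟦ m ℤ.⊖ n ⟧ ≈ m · 1# - n · 1#
  ⟦⊖⟧ zero zero = sym (trans (+-congˡ -0#≈0#) (+-identityʳ 0#))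
  ⟦⊖⟧ zero (suc n) = sym (+-identityˡ _)
  ⟦⊖⟧ (suc m) zero = sym (trans (+-congˡ -0#≈0#) (+-identityʳ _))
  ⟦⊖⟧ (suc m) (suc n) rewrite ℤ.[1+m]⊖[1+n]≡m⊖n m n = begin
    ⟦ m ℤ.⊖ n ⟧                      ≈⟨ ⟦⊖⟧ m n ⟩
    m · 1# - n · 1#                  ≈⟨ sym (+-identityˡ _) ⟩
    0# + (m · 1# - n · 1#)           ≈⟨ +-congʳ (sym (-‿inverseʳ 1#)) ⟩
    (1# - 1#) + (m · 1# - n · 1#)    ≈⟨ interchange +-commutativeSemigroup _ _ _ _ ⟩
    suc m · 1# + (- 1# - n · 1#)     ≈⟨ +-congˡ (⁻¹-∙-comm _ _) ⟩
    suc m · 1# - suc n · 1#          ∎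

  ⟦+⟧ : ∀ i j → ⟦ i ℤ.+ j ⟧ ≈ ⟦ i ⟧ + ⟦ j ⟧
  ⟦+⟧ -[1+ m ] -[1+ n ] = begin
    - (suc (suc (m ℕ.+ n)) · 1#)     ≡⟨ ≡.cong (λ k → - (suc k · 1#)) (ℕ.+-suc m n) ⟨
    - ((suc m ℕ.+ suc n) · 1#)       ≈⟨ -‿cong (×-homo-+ 1# (suc m) (suc n)) ⟩
    - (suc m · 1# + suc n · 1#)      ≈⟨ ⁻¹-∙-comm _ _ ⟨
    - (suc m · 1#) - suc n · 1#      ∎
  ⟦+⟧ -[1+ m ] (+ n) = trans (⟦⊖⟧ n (suc m)) (+-comm _ _)
  ⟦+⟧ (+ m) -[1+ n ] = ⟦⊖⟧ m (suc n)
  ⟦+⟧ (+ m) (+ n) = ×-homo-+ 1# m n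

  ⟦-⟧ : ∀ i → ⟦ ℤ.- i ⟧ ≈ - ⟦ i ⟧
  ⟦-⟧ -[1+ n ] = sym (-‿involutive _)
  ⟦-⟧ (+ zero) = sym -0#≈0#
  ⟦-⟧ (+ suc n) = refl

  ⟦_⟧ₛ : Sign → Carrier
  ⟦ Sign.+ ⟧ₛ = 1#
  ⟦ Sign.- ⟧ₛ = - 1#

  ⟦◃⟧ : ∀ s n → ⟦ s ◃ n ⟧ ≈ ⟦ s ⟧ₛ * n · 1#
  ⟦◃⟧ s zero = sym (zeroʳ _)
  ⟦◃⟧ Sign.+ (suc n) = sym (*-identityˡ _)
  ⟦◃⟧ Sign.- (suc n) = sym (-1*x≈-x _)

  ⟦sign◃∣∣⟧ : ∀ i → ⟦ i ⟧ ≈ ⟦ sign i ⟧ₛ * ∣ i ∣ · 1#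
  ⟦sign◃∣∣⟧ (+ n) = sym (*-identityˡ _)
  ⟦sign◃∣∣⟧ -[1+ n ] = sym (-1*x≈-x _)

  ⟦*⟧ₛ : ∀ s t → ⟦ s Sign.* t ⟧ₛ ≈ ⟦ s ⟧ₛ * ⟦ t ⟧ₛ
  ⟦*⟧ₛ Sign.+ t = sym (*-identityˡ _)
  ⟦*⟧ₛ Sign.- Sign.+ = sym (*-identityʳ _)
  ⟦*⟧ₛ Sign.- Sign.- = sym (trans (-1*x≈-x (- 1#)) (-‿involutive 1#))

  ⟦*⟧ : ∀ i j → ⟦ i ℤ.* j ⟧ ≈ ⟦ i ⟧ * ⟦ j ⟧
  ⟦*⟧ i j = begin
    ⟦ (sign i Sign.* sign j) ◃ (∣ i ∣ ℕ.* ∣ j ∣) ⟧                ≈⟨ ⟦◃⟧ (sign i Sign.* sign j) (∣ i ∣ ℕ.* ∣ j ∣) ⟩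
    ⟦ sign i Sign.* sign j ⟧ₛ * (∣ i ∣ ℕ.* ∣ j ∣) · 1#            ≈⟨ *-cong (⟦*⟧ₛ (sign i) (sign j)) (×1-homo-* ∣ i ∣ ∣ j ∣) ⟩
    (⟦ sign i ⟧ₛ * ⟦ sign j ⟧ₛ) * (∣ i ∣ · 1# * ∣ j ∣ · 1#)       ≈⟨ interchange *-commutativeSemigroup _ _ _ _ ⟩
    (⟦ sign i ⟧ₛ * ∣ i ∣ · 1#) * (⟦ sign j ⟧ₛ * ∣ j ∣ · 1#)       ≈⟨ *-cong (⟦sign◃∣∣⟧ i) (⟦sign◃∣∣⟧ j) ⟨
    ⟦ i ⟧ * ⟦ j ⟧                                                ∎

  homomorphism : CommutativeRing.rawRing ℤ.+-*-commutativeRing -Raw-AlmostCommutative⟶ fromCommutativeRing R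
  homomorphism = record
    { ⟦_⟧ = ⟦_⟧ ; +-homo = ⟦+⟧ ; *-homo = ⟦*⟧ ; -‿homo = ⟦-⟧
    ; 0-homo = refl ; 1-homo = +-identityʳ 1# }

  ⟦⟧-weaklyDecidable : ∀ i j → Maybe (⟦ i ⟧ ≈ ⟦ j ⟧)
  ⟦⟧-weaklyDecidable i j = Maybe.map (λ { ≡.refl → refl }) (dec⇒weaklyDec ℤ._≟_ i j)

  open import Algebra.Solver.Ring
    (CommutativeRing.rawRing ℤ.+-*-commutativeRing) (fromCommutativeRing R) homomorphism ⟦⟧-weaklyDecidable public
    using (solve; _:=_; _:+_; _:*_; :-_; _:-_; con)


module RealFieldProperties (R : RealField) where
  open RealField R
  open IsStrictTotalOrder <-isStrictTotalOrder using (compare; asym; irrefl) renaming (trans to <-trans)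

  commutativeRing : CommutativeRing 0ℓ 0ℓ
  commutativeRing = record { isCommutativeRing = isCommutativeRing }

  open CommutativeRing commutativeRing
    using (+-identityˡ; -‿inverseˡ; -‿inverseʳ; *-identityʳ; *-assoc; *-comm; zeroʳ; distribˡ; distribʳ)
  open import Algebra.Properties.Ring (CommutativeRing.ring commutativeRing) using (-1*x≈-x; -‿involutive; -‿distribʳ-*)
  open ℤ-RingSolver commutativeRing
  open ≡.≡-Reasoning

  x<0⇒0<-x : ∀ {x} → x < 0# → 0# < - x
  x<0⇒0<-x {x} x<0 = subst₂ _<_ (-‿inverseʳ x) (+-identityˡ (- x)) (+-mono-< (- x) x<0)

  0<-x⇒x<0 : ∀ {x} → 0# < - x → x < 0#
  0<-x⇒x<0 {x} 0<-x = subst₂ _<_ (+-identityˡ x) (-‿inverseˡ x) (+-mono-< x 0<-x)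

  0<1 : 0# < 1#
  0<1 with compare 0# 1#
  ... | tri< 0<1 _ _ = 0<1
  ... | tri≈ _ 0≡1 _ = ⊥-elim (0≢1 0≡1)
  ... | tri> _ _ 1<0 = ⊥-elim (asym 1<0 (subst (0# <_) -1*-1≡1 (*-pos 0<-1 0<-1)))
    where
    0<-1 = x<0⇒0<-x 1<0
    -1*-1≡1 : - 1# * - 1# ≡ 1#
    -1*-1≡1 = ≡.trans (-1*x≈-x (- 1#)) (-‿involutive 1#)

  0<2 : 0# < 1# + 1#
  0<2 = <-trans 0<1 (subst (_< 1# + 1#) (+-identityˡ 1#) (+-mono-< 1# 0<1))

  0<x⇒x≢0 : ∀ {x} → 0# < x → x ≢ 0#
  0<x⇒x≢0 0<x x≡0 = irrefl (≡.sym x≡0) 0<x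

  0<x⇒0<x⁻¹ : ∀ {x} → 0# < x → 0# < x ⁻¹
  0<x⇒0<x⁻¹ {x} 0<x with compare 0# (x ⁻¹)
  ... | tri< 0<x⁻¹ _ _ = 0<x⁻¹
  ... | tri≈ _ 0≡x⁻¹ _ = ⊥-elim (0≢1 (begin
    0#         ≡⟨ zeroʳ x ⟨
    x * 0#     ≡⟨ cong (x *_) 0≡x⁻¹ ⟩
    x * x ⁻¹   ≡⟨ ⁻¹-inverse x (0<x⇒x≢0 0<x) ⟩
    1#         ∎))
  ... | tri> _ _ x⁻¹<0 = ⊥-elim (asym 0<1 (0<-x⇒x<0 (subst (0# <_) x*-x⁻¹≡-1 (*-pos 0<x (x<0⇒0<-x x⁻¹<0)))))
    where
    x*-x⁻¹≡-1 : x * - (x ⁻¹) ≡ - 1#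
    x*-x⁻¹≡-1 = ≡.trans (≡.sym (-‿distribʳ-* x (x ⁻¹))) (cong -_ (⁻¹-inverse x (0<x⇒x≢0 0<x)))

  ≢0∧≮0⇒0< : ∀ {x} → x ≢ 0# → ¬ x < 0# → 0# < x
  ≢0∧≮0⇒0< {x} x≢0 x≮0 with compare 0# x
  ... | tri< 0<x _ _ = 0<x
  ... | tri≈ _ 0≡x _ = ⊥-elim (x≢0 (≡.sym 0≡x))
  ... | tri> _ _ x<0 = ⊥-elim (x≮0 x<0)

  y*[x*y⁻¹]≡x : ∀ {y} x → y ≢ 0# → y * (x * y ⁻¹) ≡ x
  y*[x*y⁻¹]≡x {y} x y≢0 = begin
    y * (x * y ⁻¹)  ≡⟨ solve 3 (λ y x w → y :* (x :* w) := x :* (y :* w)) ≡.refl y x (y ⁻¹) ⟩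
    x * (y * y ⁻¹)  ≡⟨ cong (x *_) (⁻¹-inverse y y≢0) ⟩
    x * 1#          ≡⟨ *-identityʳ x ⟩
    x               ∎

  [x*y⁻¹]*y≡x : ∀ {y} x → y ≢ 0# → x * y ⁻¹ * y ≡ x
  [x*y⁻¹]*y≡x {y} x y≢0 = ≡.trans (*-comm (x * y ⁻¹) y) (y*[x*y⁻¹]≡x x y≢0)

  half : Carrier → Carrier
  half x = x * (1# + 1#) ⁻¹

  0<half : ∀ {x} → 0# < x → 0# < half x
  0<half 0<x = *-pos 0<x (0<x⇒0<x⁻¹ 0<2)

  half+half : ∀ x → half x + half x ≡ x
  half+half x = begin
    x * ½ + x * ½          ≡⟨ distribʳ ½ x x ⟨
    (x + x) * ½            ≡⟨ cong (_* ½) (≡.cong₂ _+_ (*-identityʳ x) (*-identityʳ x)) ⟨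
    (x * 1# + x * 1#) * ½  ≡⟨ cong (_* ½) (distribˡ x 1# 1#) ⟨
    x * (1# + 1#) * ½      ≡⟨ *-assoc x (1# + 1#) ½ ⟩
    x * ((1# + 1#) * ½)    ≡⟨ cong (x *_) (⁻¹-inverse (1# + 1#) (0<x⇒x≢0 0<2)) ⟩
    x * 1#                 ≡⟨ *-identityʳ x ⟩
    x                      ∎
    where ½ = (1# + 1#) ⁻¹

  [q-ε]*p+η≡q*p-η : ∀ q ε p → (q + - ε) * p + half (ε * p) ≡ q * p + - half (ε * p)
  [q-ε]*p+η≡q*p-η q ε p = begin
    (q + - ε) * p + η         ≡⟨ solve 4 (λ q ε p η → (q :+ :- ε) :* p :+ η := q :* p :+ :- (ε :* p) :+ η) ≡.refl q ε p η ⟩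
    q * p + - (ε * p) + η     ≡⟨ cong (λ u → q * p + - u + η) (half+half (ε * p)) ⟨
    q * p + - (η + η) + η     ≡⟨ solve 2 (λ a η → a :+ :- (η :+ η) :+ η := a :+ :- η) ≡.refl (q * p) η ⟩
    q * p + - η               ∎
    where η = half (ε * p)

  q*p+η≡[q+ε]*p-η : ∀ q ε p → q * p + half (ε * p) ≡ (q + ε) * p + - half (ε * p)
  q*p+η≡[q+ε]*p-η q ε p = begin
    q * p + η                 ≡⟨ solve 2 (λ a η → a :+ η := a :+ (η :+ η) :+ :- η) ≡.refl (q * p) η ⟩
    q * p + (η + η) + - η     ≡⟨ cong (λ u → q * p + u + - η) (half+half (ε * p)) ⟩
    q * p + ε * p + - η       ≡⟨ cong (_+ - η) (distribʳ p q ε) ⟨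
    (q + ε) * p + - η         ∎
    where η = half (ε * p)

module _ {R : RealField} (T : RAlgebra R) where
  private module ℝ where
    open RealField R public
    open CommutativeRing (RealFieldProperties.commutativeRing R) public using (+-identityʳ; -‿inverseʳ)
  open RAlgebra T
  open RealFieldProperties R hiding (commutativeRing)
  open IsStrictTotalOrder ℝ.<-isStrictTotalOrder using (compare)

  commutativeRing : CommutativeRing 0ℓ 0ℓ
  commutativeRing = record { isCommutativeRing = isCommutativeRing }

  open CommutativeRing commutativeRing using (*-identityˡ; *-identityʳ; *-assoc; zeroˡ; distribʳ)
  open import Algebra.Properties.Ring (CommutativeRing.ring commutativeRing) using (x+x≈x⇒x≈0; +-inverseʳ-unique)
  open ℤ-RingSolver commutativeRing
  open ≡.≡-Reasoning

  ι-0# : ι ℝ.0# ≡ 0#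
  ι-0# = x+x≈x⇒x≈0 (ι ℝ.0#) (≡.trans (≡.sym (ι-+ ℝ.0# ℝ.0#)) (cong ι (ℝ.+-identityʳ ℝ.0#)))

  ι-‿ : ∀ r → ι (ℝ.- r) ≡ - ι r
  ι-‿ r = +-inverseʳ-unique (ι r) (ι (ℝ.- r)) (begin
    ι r + ι (ℝ.- r)   ≡⟨ ι-+ r (ℝ.- r) ⟨
    ι (r ℝ.+ ℝ.- r)   ≡⟨ cong ι (ℝ.-‿inverseʳ r) ⟩
    ι ℝ.0#            ≡⟨ ι-0# ⟩
    0#                ∎)

  ι-*+ : ∀ s z t → ι (s ℝ.* z ℝ.+ t) ≡ ι s ∙ ι z + ι t
  ι-*+ s z t = ≡.trans (ι-+ (s ℝ.* z) t) (cong (_+ ι t) (ι-* s z))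

  ∙-isEvent : ∀ {A B} → IsEvent A → IsEvent B → IsEvent (A ∙ B)
  ∙-isEvent {A} {B} A² B² = begin
    (A ∙ B) ∙ (A ∙ B)   ≡⟨ solve 2 (λ a b → (a :* b) :* (a :* b) := (a :* a) :* (b :* b)) ≡.refl A B ⟩
    (A ∙ A) ∙ (B ∙ B)   ≡⟨ ≡.cong₂ _∙_ A² B² ⟩
    A ∙ B               ∎

  1-isEvent : ∀ {C} → IsEvent C → IsEvent (1# - C)
  1-isEvent {C} C² = begin
    (1# - C) ∙ (1# - C)             ≡⟨ solve 2 (λ o c → (o :- c) :* (o :- c) := o :* o :- o :* c :- o :* c :+ c :* c) ≡.refl 1# C ⟩
    1# ∙ 1# - 1# ∙ C - 1# ∙ C + C ∙ C ≡⟨ ≡.cong₂ (λ u v → u - v - v + C ∙ C) (*-identityˡ 1#) (*-identityˡ C) ⟩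
    1# - C - C + C ∙ C              ≡⟨ cong ((1# - C - C) +_) C² ⟩
    1# - C - C + C                  ≡⟨ solve 2 (λ o c → o :- c :- c :+ c := o :- c) ≡.refl 1# C ⟩
    1# - C                          ∎

  Cond-isPlausible : ∀ {_≲_ D} → IsPlausible T _≲_ → IsEvent D → IsPlausible T (Cond T _≲_ D)
  Cond-isPlausible {_≲_} {D} pl D² = record
    { events-nonneg = λ A A² → nonneg (events-nonneg (A ∙ D) (∙-isEvent A² D²))
    ; +-nonneg = λ X Y 0≲X 0≲Y →
        nonneg (subst (0# ≲_) (≡.sym (distribʳ D X Y)) (+-nonneg _ _ (nonneg⁻ 0≲X) (nonneg⁻ 0≲Y)))
    ; ·-nonneg = λ X q 0≲X 0≤q →
        nonneg (subst (0# ≲_) (≡.sym (*-assoc (ι q) X D)) (·-nonneg (X ∙ D) q (nonneg⁻ 0≲X) 0≤q))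
    ; ≲⇒diff = λ X Y X≲Y → nonneg (subst (0# ≲_) (diff-∙ X Y) (≲⇒diff _ _ X≲Y))
    ; diff⇒≲ = λ X Y 0≲Y-X → diff⇒≲ _ _ (subst (0# ≲_) (≡.sym (diff-∙ X Y)) (nonneg⁻ 0≲Y-X))
    }
    where
    open IsPlausible pl
    nonneg : ∀ {Z} → 0# ≲ (Z ∙ D) → Cond T _≲_ D 0# Z
    nonneg = subst (_≲ _) (≡.sym (zeroˡ D))
    nonneg⁻ : ∀ {Z} → Cond T _≲_ D 0# Z → 0# ≲ (Z ∙ D)
    nonneg⁻ = subst (_≲ _) (zeroˡ D)
    diff-∙ : ∀ X Y → Y ∙ D - X ∙ D ≡ (Y - X) ∙ D
    diff-∙ X Y = solve 3 (λ x y d → y :* d :- x :* d := (y :- x) :* d) ≡.refl X Y D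

  Strict-cong : ∀ {_≲₁_ _≲₂_} → (∀ {U V} → U ≲₁ V → U ≲₂ V) → (∀ {U V} → U ≲₂ V → U ≲₁ V) →
                ∀ {U V} → Strict T _≲₁_ U V → Strict T _≲₂_ U V
  Strict-cong f g (U≲V , V≴U) = f U≲V , λ V≲U → V≴U (g V≲U)

  ExpIs-cong : ∀ {_≲₁_ _≲₂_} → (∀ {U V} → U ≲₁ V → U ≲₂ V) → (∀ {U V} → U ≲₂ V → U ≲₁ V) →
               ∀ {X v} → ExpIs T _≲₁_ X v → ExpIs T _≲₂_ X v
  ExpIs-cong {_≲₁_} {_≲₂_} f g {v = fin x} E ε 0<ε =
    Strict-cong {_≲₁_} {_≲₂_} f g (proj₁ (E ε 0<ε)) , Strict-cong {_≲₁_} {_≲₂_} f g (proj₂ (E ε 0<ε))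
  ExpIs-cong {_≲₁_} {_≲₂_} f g {v = +∞} E y = Strict-cong {_≲₁_} {_≲₂_} f g (E y)
  ExpIs-cong {_≲₁_} {_≲₂_} f g {v = -∞} E y = Strict-cong {_≲₁_} {_≲₂_} f g (E y)

  CondExpIs-Cond : ∀ {_≲_ X C D v} → CondExpIs T (Cond T _≲_ D) X C v → CondExpIs T _≲_ X (C ∙ D) v
  CondExpIs-Cond {_≲_} {C = C} {D} =
    ExpIs-cong (λ {U} {V} → subst₂ _≲_ (*-assoc U C D) (*-assoc V C D))
               (λ {U} {V} → subst₂ _≲_ (≡.sym (*-assoc U C D)) (≡.sym (*-assoc V C D)))

  module PlausibleOrder {_≲_ : Carrier → Carrier → Set} (pl : IsPlausible T _≲_) where
    open IsPlausible pl

    -- an alias of the parameter, which cannot be given a fixity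
    infix 4 _≼_ _≺_
    _≼_ : Carrier → Carrier → Set
    _≼_ = _≲_

    _≺_ : Carrier → Carrier → Set
    _≺_ = Strict T _≼_

    ≼-resp-diff : ∀ {A B A′ B′} → B - A ≡ B′ - A′ → A ≼ B → A′ ≼ B′
    ≼-resp-diff e A≼B = diff⇒≲ _ _ (subst (0# ≼_) e (≲⇒diff _ _ A≼B))

    ≺-resp-diff : ∀ {A B A′ B′} → B - A ≡ B′ - A′ → A ≺ B → A′ ≺ B′
    ≺-resp-diff {A} {B} {A′} {B′} e (A≼B , B⋠A) = ≼-resp-diff e A≼B , λ B′≼A′ → B⋠A (≼-resp-diff e′ B′≼A′)
      where
      e′ : A′ - B′ ≡ A - B
      e′ = begin
        A′ - B′        ≡⟨ solve 2 (λ a b → a :- b := :- (b :- a)) ≡.refl A′ B′ ⟩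
        - (B′ - A′)    ≡⟨ cong -_ e ⟨
        - (B - A)      ≡⟨ solve 2 (λ a b → :- (b :- a) := a :- b) ≡.refl A B ⟩
        A - B          ∎

    ≼-trans : ∀ {A B C} → A ≼ B → B ≼ C → A ≼ C
    ≼-trans {A} {B} {C} A≼B B≼C =
      diff⇒≲ _ _ (subst (0# ≼_) e (+-nonneg _ _ (≲⇒diff _ _ A≼B) (≲⇒diff _ _ B≼C)))
      where
      e : (B - A) + (C - B) ≡ C - A
      e = solve 3 (λ a b c → (b :- a) :+ (c :- b) := c :- a) ≡.refl A B C

    ≼-≺-trans : ∀ {A B C} → A ≼ B → B ≺ C → A ≺ C
    ≼-≺-trans A≼B (B≼C , C⋠B) = ≼-trans A≼B B≼C , λ C≼A → C⋠B (≼-trans C≼A A≼B)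

    ≺-≼-trans : ∀ {A B C} → A ≺ B → B ≼ C → A ≺ C
    ≺-≼-trans (A≼B , B⋠A) B≼C = ≼-trans A≼B B≼C , λ C≼A → B⋠A (≼-trans B≼C C≼A)

    0≼ι : ∀ {r} → ℝ.0# ℝ.≤ r → 0# ≼ ι r
    0≼ι {r} 0≤r = subst (0# ≼_) (*-identityʳ (ι r)) (·-nonneg 1# r (events-nonneg 1# (*-identityˡ 1#)) 0≤r)

    ·-monotone : ∀ {s A B} → ℝ.0# ℝ.≤ s → A ≼ B → ι s ∙ A ≼ ι s ∙ B
    ·-monotone {s} {A} {B} 0≤s A≼B =
      diff⇒≲ _ _ (subst (0# ≼_) e (·-nonneg (B - A) s (≲⇒diff _ _ A≼B) 0≤s))
      where
      e : ι s ∙ (B - A) ≡ ι s ∙ B - ι s ∙ A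
      e = solve 3 (λ k a b → k :* (b :- a) := k :* b :- k :* a) ≡.refl (ι s) A B

    Negligible : Carrier → Set
    Negligible V = ∀ ε → ℝ.0# ℝ.< ε → - ι ε ≼ V × V ≼ ι ε

    0-negligible : Negligible 0#
    0-negligible ε 0<ε = ≼-resp-diff e 0≼ιε , 0≼ιε
      where
      0≼ιε = 0≼ι (inj₁ 0<ε)
      e : ι ε - 0# ≡ 0# - - ι ε
      e = solve 1 (λ k → k :- con 0ℤ := con 0ℤ :- :- k) ≡.refl (ι ε)

    -‿negligible : ∀ {V} → Negligible V → Negligible (- V)
    -‿negligible {V} N ε 0<ε = ≼-resp-diff e₁ (proj₂ (N ε 0<ε)) , ≼-resp-diff e₂ (proj₁ (N ε 0<ε))
      where
      e₁ : ι ε - V ≡ - V - - ι ε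
      e₁ = solve 2 (λ k v → k :- v := :- v :- :- k) ≡.refl (ι ε) V
      e₂ : V - - ι ε ≡ ι ε - - V
      e₂ = solve 2 (λ k v → v :- :- k := k :- :- v) ≡.refl (ι ε) V

    ·-negligible⁺ : ∀ {s V} → ℝ.0# ℝ.< s → Negligible V → Negligible (ι s ∙ V)
    ·-negligible⁺ {s} {V} 0<s N ε 0<ε =
      subst (_≼ ι s ∙ V) sδ⁻≡ε⁻ (·-monotone 0≤s (proj₁ (N δ 0<δ))) ,
      subst (ι s ∙ V ≼_) sδ≡ε (·-monotone 0≤s (proj₂ (N δ 0<δ)))
      where
      0≤s = inj₁ 0<s
      δ = ε ℝ.* s ℝ.⁻¹
      0<δ = ℝ.*-pos 0<ε (0<x⇒0<x⁻¹ 0<s)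
      sδ≡ε : ι s ∙ ι δ ≡ ι ε
      sδ≡ε = ≡.trans (≡.sym (ι-* s δ)) (cong ι (y*[x*y⁻¹]≡x ε (0<x⇒x≢0 0<s)))
      sδ⁻≡ε⁻ : ι s ∙ - ι δ ≡ - ι ε
      sδ⁻≡ε⁻ = ≡.trans (solve 2 (λ k d → k :* :- d := :- (k :* d)) ≡.refl (ι s) (ι δ)) (cong -_ sδ≡ε)

    ·-negligible : ∀ {V} s → Negligible V → Negligible (ι s ∙ V)
    ·-negligible {V} s N with compare ℝ.0# s
    ... | tri< 0<s _ _ = ·-negligible⁺ 0<s N
    ... | tri≈ _ 0≡s _ = subst Negligible (≡.sym ιsV≡0) 0-negligible
      where
      ιsV≡0 : ι s ∙ V ≡ 0#
      ιsV≡0 = begin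
        ι s ∙ V      ≡⟨ cong (λ r → ι r ∙ V) 0≡s ⟨
        ι ℝ.0# ∙ V   ≡⟨ cong (_∙ V) ι-0# ⟩
        0# ∙ V       ≡⟨ zeroˡ V ⟩
        0#           ∎
    ... | tri> _ _ s<0 = subst Negligible ι[-s]∙-V≡ιs∙V (·-negligible⁺ (x<0⇒0<-x s<0) (-‿negligible N))
      where
      ι[-s]∙-V≡ιs∙V : ι (ℝ.- s) ∙ - V ≡ ι s ∙ V
      ι[-s]∙-V≡ιs∙V = ≡.trans (cong (_∙ - V) (ι-‿ s)) (solve 2 (λ k v → :- k :* :- v := k :* v) ≡.refl (ι s) V)

    negligible-upperBound : ∀ {Z z} → Negligible (Z - ι z) → ∀ s {η} → ℝ.0# ℝ.< η →
                            ι s ∙ Z ≼ ι (s ℝ.* z ℝ.+ η)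
    negligible-upperBound {Z} {z} N s {η} 0<η = ≼-resp-diff e (proj₂ (·-negligible s N η 0<η))
      where
      e : ι η - ι s ∙ (Z - ι z) ≡ ι (s ℝ.* z ℝ.+ η) - ι s ∙ Z
      e = ≡.trans (solve 4 (λ h k w x → h :- k :* (w :- x) := k :* x :+ h :- k :* w) ≡.refl (ι η) (ι s) Z (ι z))
                  (cong (_- ι s ∙ Z) (≡.sym (ι-*+ s z η)))

    negligible-lowerBound : ∀ {Z z} → Negligible (Z - ι z) → ∀ s {η} → ℝ.0# ℝ.< η →
                            ι (s ℝ.* z ℝ.+ ℝ.- η) ≼ ι s ∙ Z
    negligible-lowerBound {Z} {z} N s {η} 0<η = ≼-resp-diff e (proj₁ (·-negligible s N η 0<η))
      where
      e : ι s ∙ (Z - ι z) - - ι η ≡ ι s ∙ Z - ι (s ℝ.* z ℝ.+ ℝ.- η)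
      e = begin
        ι s ∙ (Z - ι z) - - ι η             ≡⟨ solve 4 (λ h k w x → k :* (w :- x) :- :- h := k :* w :- (k :* x :+ :- h)) ≡.refl (ι η) (ι s) Z (ι z) ⟩
        ι s ∙ Z - (ι s ∙ ι z + - ι η)        ≡⟨ cong (λ u → ι s ∙ Z - (ι s ∙ ι z + u)) (ι-‿ η) ⟨
        ι s ∙ Z - (ι s ∙ ι z + ι (ℝ.- η))    ≡⟨ cong (λ u → ι s ∙ Z - u) (ι-*+ s z (ℝ.- η)) ⟨
        ι s ∙ Z - ι (s ℝ.* z ℝ.+ ℝ.- η)      ∎

    fin-expectation⇒negligible : ∀ {Z z} → ExpIs T _≼_ Z (fin z) → Negligible (Z - ι z)
    fin-expectation⇒negligible {Z} {z} E ε 0<ε =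
      subst (_≼ Z - ι z) (ι-‿ ε) (proj₁ (proj₁ (E ε 0<ε))) , proj₁ (proj₂ (E ε 0<ε))

    fin-expectation⇒ι≺ : ∀ {Z z η} → ExpIs T _≼_ Z (fin z) → ℝ.0# ℝ.< η → ι (z ℝ.+ ℝ.- η) ≺ Z
    fin-expectation⇒ι≺ {Z} {z} {η} E 0<η = ≺-resp-diff e (proj₁ (E η 0<η))
      where
      e : (Z - ι z) - ι (ℝ.- η) ≡ Z - ι (z ℝ.+ ℝ.- η)
      e = begin
        (Z - ι z) - ι (ℝ.- η)       ≡⟨ solve 3 (λ w x y → (w :- x) :- y := w :- (x :+ y)) ≡.refl Z (ι z) (ι (ℝ.- η)) ⟩
        Z - (ι z + ι (ℝ.- η))       ≡⟨ cong (λ u → Z - u) (ι-+ z (ℝ.- η)) ⟨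
        Z - ι (z ℝ.+ ℝ.- η)         ∎

    fin-expectation⇒≺ι : ∀ {Z z η} → ExpIs T _≼_ Z (fin z) → ℝ.0# ℝ.< η → Z ≺ ι (z ℝ.+ η)
    fin-expectation⇒≺ι {Z} {z} {η} E 0<η = ≺-resp-diff e (proj₂ (E η 0<η))
      where
      e : ι η - (Z - ι z) ≡ ι (z ℝ.+ η) - Z
      e = ≡.trans (solve 3 (λ h w x → h :- (w :- x) := (x :+ h) :- w) ≡.refl (ι η) Z (ι z))
                  (cong (_- Z) (≡.sym (ι-+ z η)))

    event-expectation-≮0 : ∀ {C p} → IsEvent C → ExpIs T _≼_ C (fin p) → ¬ p ℝ.< ℝ.0#
    event-expectation-≮0 {C} {p} C² E p<0 =
      proj₂ (proj₂ (E (ℝ.- p) (x<0⇒0<-x p<0))) (≼-resp-diff e (events-nonneg C C²))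
      where
      e : C - 0# ≡ (C - ι p) - ι (ℝ.- p)
      e = ≡.trans (solve 2 (λ c x → c :- con 0ℤ := (c :- x) :- :- x) ≡.refl C (ι p))
                  (cong (λ u → C - ι p - u) (≡.sym (ι-‿ p)))

    event-expectation-≢+∞ : ∀ {C} → IsEvent C → ¬ ExpIs T _≼_ C +∞
    event-expectation-≢+∞ {C} C² E = proj₂ (E ℝ.1#) (≼-resp-diff e (events-nonneg (1# - C) (1-isEvent C²)))
      where
      e : (1# - C) - 0# ≡ ι ℝ.1# - C
      e = ≡.trans (solve 2 (λ o c → (o :- c) :- con 0ℤ := o :- c) ≡.refl 1# C) (cong (_- C) (≡.sym ι-1))

    event-expectation-≢-∞ : ∀ {C} → IsEvent C → ¬ ExpIs T _≼_ C -∞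
    event-expectation-≢-∞ {C} C² E = proj₂ (E ℝ.0#) (subst (_≼ C) (≡.sym ι-0#) (events-nonneg C C²))

    condExp-fin : ∀ {X C p q} → ℝ.0# ℝ.< p → ExpIs T _≼_ (X ∙ C) (fin (q ℝ.* p)) → ExpIs T _≼_ C (fin p) →
                  CondExpIs T _≼_ X C (fin q)
    condExp-fin {X} {C} {p} {q} 0<p EXC EC ε 0<ε = lower , upper
      where
      η = half (ε ℝ.* p)
      0<η = 0<half (ℝ.*-pos 0<ε 0<p)
      N = fin-expectation⇒negligible EC

      [q-ε]C≼qp-η : ι (q ℝ.+ ℝ.- ε) ∙ C ≼ ι (q ℝ.* p ℝ.+ ℝ.- η)
      [q-ε]C≼qp-η = subst (λ r → ι (q ℝ.+ ℝ.- ε) ∙ C ≼ ι r) ([q-ε]*p+η≡q*p-η q ε p)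
                          (negligible-upperBound N (q ℝ.+ ℝ.- ε) 0<η)

      qp+η≼[q+ε]C : ι (q ℝ.* p ℝ.+ η) ≼ ι (q ℝ.+ ε) ∙ C
      qp+η≼[q+ε]C = subst (λ r → ι r ≼ ι (q ℝ.+ ε) ∙ C) (≡.sym (q*p+η≡[q+ε]*p-η q ε p))
                          (negligible-lowerBound N (q ℝ.+ ε) 0<η)

      lower : ι (ℝ.- ε) ∙ C ≺ (X - ι q) ∙ C
      lower = ≺-resp-diff e (≼-≺-trans [q-ε]C≼qp-η (fin-expectation⇒ι≺ EXC 0<η))
        where
        e : X ∙ C - ι (q ℝ.+ ℝ.- ε) ∙ C ≡ (X - ι q) ∙ C - ι (ℝ.- ε) ∙ C
        e = begin
          X ∙ C - ι (q ℝ.+ ℝ.- ε) ∙ C  ≡⟨ cong (λ u → X ∙ C - u ∙ C) (ι-+ q (ℝ.- ε)) ⟩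
          X ∙ C - (ι q + ι (ℝ.- ε)) ∙ C ≡⟨ solve 4 (λ x c k d → x :* c :- (k :+ d) :* c := (x :- k) :* c :- d :* c) ≡.refl X C (ι q) (ι (ℝ.- ε)) ⟩
          (X - ι q) ∙ C - ι (ℝ.- ε) ∙ C ∎

      upper : (X - ι q) ∙ C ≺ ι ε ∙ C
      upper = ≺-resp-diff e (≺-≼-trans (fin-expectation⇒≺ι EXC 0<η) qp+η≼[q+ε]C)
        where
        e : ι (q ℝ.+ ε) ∙ C - X ∙ C ≡ ι ε ∙ C - (X - ι q) ∙ C
        e = ≡.trans (cong (λ u → u ∙ C - X ∙ C) (ι-+ q ε))
                    (solve 4 (λ x c k d → (k :+ d) :* c :- x :* c := d :* c :- (x :- k) :* c) ≡.refl X C (ι q) (ι ε))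

    condExp-+∞ : ∀ {X C p} → ℝ.0# ℝ.< p → ExpIs T _≼_ (X ∙ C) +∞ → ExpIs T _≼_ C (fin p) →
                 CondExpIs T _≼_ X C +∞
    condExp-+∞ {p = p} 0<p EXC EC y =
      ≼-≺-trans (negligible-upperBound (fin-expectation⇒negligible EC) y 0<p) (EXC (y ℝ.* p ℝ.+ p))

    condExp--∞ : ∀ {X C p} → ℝ.0# ℝ.< p → ExpIs T _≼_ (X ∙ C) -∞ → ExpIs T _≼_ C (fin p) →
                 CondExpIs T _≼_ X C -∞
    condExp--∞ {p = p} 0<p EXC EC y =
      ≺-≼-trans (EXC (y ℝ.* p ℝ.+ ℝ.- p)) (negligible-lowerBound (fin-expectation⇒negligible EC) y 0<p)

    condExp-ratio : ∀ {X C a p q} → IsEvent C → ExpIs T _≼_ (X ∙ C) a → ExpIs T _≼_ C p → DivIs a p q →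
                    CondExpIs T _≼_ X C q
    condExp-ratio C² EXC EC (fin/fin x y y≢0) =
      condExp-fin (≢0∧≮0⇒0< y≢0 (event-expectation-≮0 C² EC))
                  (subst (λ a → ExpIs T _≼_ _ (fin a)) (≡.sym ([x*y⁻¹]*y≡x x y≢0)) EXC) EC
    condExp-ratio C² EXC EC (fin/+∞ x) = ⊥-elim (event-expectation-≢+∞ C² EC)
    condExp-ratio C² EXC EC (fin/-∞ x) = ⊥-elim (event-expectation-≢-∞ C² EC)
    condExp-ratio C² EXC EC (+∞/pos y 0<y) = condExp-+∞ 0<y EXC EC
    condExp-ratio C² EXC EC (+∞/neg y y<0) = ⊥-elim (event-expectation-≮0 C² EC y<0)
    condExp-ratio C² EXC EC (-∞/pos y 0<y) = condExp--∞ 0<y EXC EC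
    condExp-ratio C² EXC EC (-∞/neg y y<0) = ⊥-elim (event-expectation-≮0 C² EC y<0)

mainTheorem6 :
    (R : RealField) (T : RAlgebra R)
    (_≲_ : RAlgebra.Carrier T → RAlgebra.Carrier T → Set) →
    IsPlausible T _≲_ →
    (X C D : RAlgebra.Carrier T) →
    RAlgebra.IsEvent T C → RAlgebra.IsEvent T D →
    (a p q : ExtReal R) →
    CondExpIs T _≲_ (RAlgebra._∙_ T X C) D a →
    CondProbIs T _≲_ C D p →
    DivIs a p q →
    CondExpIs T _≲_ X (RAlgebra._∙_ T C D) q
mainTheorem6 R T _≲_ pl X C D C² D² a p q E[XC|D]≡a P[C|D]≡p a/p≡q =
  CondExpIs-Cond T {_≲_} {C = C} {D} (condExp-ratio C² E[XC|D]≡a P[C|D]≡p a/p≡q)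
  where open PlausibleOrder T (Cond-isPlausible T pl D²)
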